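{- Let $a,b,c,n$ be integers such that $2\nmid ac$, $2\mid b$ and $4\nmid b$. Let $n>2$ be even and let $F(x)=\frac{a+a^2}{2}x^2+\left(ac+\frac{b}{2}\right)x+\frac{c+c^2}{2}\in\mathbb{Z}[x]$. Then $F(x)$ is coprime to $x^{n/2}+ax+c$ modulo $2$ (i.e. their reductions in $\mathbb{F}_2[x]$ are coprime) if and only if $a\equiv 1\pmod 4$ or $c\equiv 1\pmod 4$. -}

module Defs where

open import Data.Bool using (Bool; true; false; _xor_; if_then_else_)
open import Data.Nat as ℕ using (ℕ; _≡ᵇ_)
open import Data.Integer as ℤ using (ℤ)
open import Data.Integer.DivMod using (_%ℕ_)
open import Data.List using (List; []; _∷_; map; replicate; _++_)
open import Data.List.Relation.Unary.All using (All)
open import Data.Product using (∃)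
open import Relation.Binary.PropositionalEquality using (_≡_)

-- Polynomials with integer coefficients: coefficient lists, constant
-- term first.

PolyZ : Set
PolyZ = List ℤ

infixl 6 _+ℤ[x]_
_+ℤ[x]_ : PolyZ → PolyZ → PolyZ
[] +ℤ[x] q = q
(a ∷ p) +ℤ[x] [] = a ∷ p
(a ∷ p) +ℤ[x] (b ∷ q) = (a ℤ.+ b) ∷ (p +ℤ[x] q)

monoZ : ℕ → ℤ → PolyZ
monoZ k z = replicate k (ℤ.+ 0) ++ (z ∷ [])

-- Polynomials over 𝔽₂ = Bool (false = 0, true = 1, addition = xor),
-- coefficient lists, constant term first; equality up to trailing zeros.

F2Poly : Set
F2Poly = List Bool

infixl 6 _+₂_
_+₂_ : F2Poly → F2Poly → F2Poly
[] +₂ q = q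
(a ∷ p) +₂ [] = a ∷ p
(a ∷ p) +₂ (b ∷ q) = (a xor b) ∷ (p +₂ q)

infixl 7 _*₂_
_*₂_ : F2Poly → F2Poly → F2Poly
[] *₂ q = []
(a ∷ p) *₂ q = (if a then q else []) +₂ (false ∷ (p *₂ q))

IsZero₂ : F2Poly → Set
IsZero₂ p = All (_≡ false) p

infix 4 _≈₂_
_≈₂_ : F2Poly → F2Poly → Set
p ≈₂ q = IsZero₂ (p +₂ q)

one₂ : F2Poly
one₂ = true ∷ []

infix 4 _∣₂_
_∣₂_ : F2Poly → F2Poly → Set
d ∣₂ f = ∃ λ q → d *₂ q ≈₂ f

IsUnit₂ : F2Poly → Set
IsUnit₂ u = ∃ λ v → u *₂ v ≈₂ one₂

Coprime₂ : F2Poly → F2Poly → Set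
Coprime₂ f g = ∀ d → d ∣₂ f → d ∣₂ g → IsUnit₂ d

bit : ℤ → Bool
bit z = (z %ℕ 2) ≡ᵇ 1

reduce₂ : PolyZ → F2Poly
reduce₂ = map bit

Fpoly : ℤ → ℤ → ℤ → PolyZ
Fpoly a b c =
  monoZ 2 ((a ℤ.+ a ℤ.* a) ℤ./ ℤ.+ 2)
  +ℤ[x] monoZ 1 (a ℤ.* c ℤ.+ b ℤ./ ℤ.+ 2)
  +ℤ[x] monoZ 0 ((c ℤ.+ c ℤ.* c) ℤ./ ℤ.+ 2)

Gpoly : ℕ → ℤ → ℤ → PolyZ
Gpoly m a c = monoZ m (ℤ.+ 1) +ℤ[x] monoZ 1 a +ℤ[x] monoZ 0 c

-- Reduction modulo 2 (bit) is a ring homomorphism ℤ → 𝔽₂.  For odd a the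
-- coefficient (a + a²)/2 = a(a+1)/2 is odd exactly when a ≡ 1 (mod 4), and
-- ac + b/2 is a sum of two odd numbers, so F reduces to α x² + γ with
-- α = [a ≡ 1 mod 4] and γ = [c ≡ 1 mod 4], while G reduces to the trinomial
-- x^m + x + 1 with m = n/2 ≥ 2.  If α = γ = 0, F reduces to 0 and its gcd with
-- the trinomial is the trinomial itself, not a unit since units of 𝔽₂[x] are
-- constants.  If α = 0 and γ = 1, F reduces to 1.  If α = 1, the Euclidean step
-- x^(k+2) + x + 1 = (x² + γ) x^k + (γ x^k + x + 1) lowers the exponent: for
-- x² + 1 it descends to x or 1, both coprime to x² + 1, and for x² it lands on
-- x + 1, which is coprime to x².

{-# OPTIONS --safe #-}
module Submission where

open import Defs
open import Data.Nat as ℕ using (ℕ)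
open import Data.Integer as ℤ using (ℤ)
open import Data.Integer.Divisibility using (_∣_)
open import Data.Nat.Divisibility as ℕD using ()
open import Data.Integer.DivMod using (_%ℕ_)
open import Data.Sum using (_⊎_)
open import Function.Bundles using (_⇔_)
open import Relation.Nullary using (¬_)
open import Relation.Binary.PropositionalEquality using (_≡_)

open import Algebra.Solver.Ring.AlmostCommutativeRing using (fromCommutativeRing)
import Algebra.Solver.Ring.Simple as RingSolver
open import Data.Bool using (Bool; true; false; T; _xor_; _∧_; if_then_else_)
open import Data.Bool.Properties as Boolₚ
  using ( xor-∧-commutativeRing; xor-identityʳ; xor-same; ∧-zeroʳ; ∧-distribʳ-xor
        ; ∧-conicalˡ; ∧-conicalʳ; ¬-not)
open import Data.Empty using (⊥-elim)
open import Data.Integer using (+_; _+_; _*_; _/_)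
open import Data.Integer.DivMod using (_/ℕ_; a≡a%ℕn+[a/ℕn]*n; n%ℕd<d; div-pos-is-/ℕ)
import Data.Integer.Divisibility.Signed as Signed
import Data.Integer.Properties as ℤₚ
open import Data.Integer.Tactic.RingSolver using (solve-∀)
open import Data.List using ([]; _∷_; _++_; replicate; length)
open import Data.List.Relation.Unary.All using ([]; _∷_)
open import Data.Nat using (zero; suc; _≡ᵇ_; _≤_; _<_; z≤n; s≤s)
open import Data.Nat.DivMod using (m*n/n≡m)
import Data.Nat.Properties as ℕₚ
open import Data.Product using (_×_; _,_; ∃)
open import Data.Sum using (inj₁; inj₂; [_,_]′)
open import Data.Sum.Function.Propositional using (_⊎-⇔_)
open import Function using (_∘_)
open import Function.Bundles using (mk⇔)
import Function.Properties.Equivalence as ⇔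
open import Relation.Binary.Bundles using (Setoid)
open import Relation.Binary.PropositionalEquality
  using (_≢_; refl; sym; trans; cong; cong₂; subst; subst₂; module ≡-Reasoning)
import Relation.Binary.Reasoning.Setoid as SetoidReasoning
open import Relation.Nullary using (contradiction)

-- (Bool, xor, ∧) is the field 𝔽₂, so the solver also cancels x xor x.
module 𝔽₂-Solver = RingSolver (fromCommutativeRing xor-∧-commutativeRing) Boolₚ._≟_

-- Parity

1≢n*2 : ∀ t → + 1 ≢ t * + 2
1≢n*2 t eq with ℤ.∣ t ∣ | trans (cong ℤ.∣_∣ eq) (ℤₚ.abs-* t (+ 2))
... | zero  | ()
... | suc _ | ()

odd≢even : ∀ q w → + 1 + q * + 2 ≢ w * + 2
odd≢even q w eq = 1≢n*2 (w ℤ.- q) (trans (shift q) (trans (cong (ℤ._- q * + 2) eq) (factor q w)))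
  where
  shift : ∀ q → + 1 ≡ (+ 1 + q * + 2) ℤ.- q * + 2
  shift = solve-∀
  factor : ∀ q w → w * + 2 ℤ.- q * + 2 ≡ (w ℤ.- q) * + 2
  factor = solve-∀

%ℕ2-unique : ∀ z r q → r < 2 → z ≡ + r + q * + 2 → z %ℕ 2 ≡ r
%ℕ2-unique z r q r<2 z≡ with z %ℕ 2 | n%ℕd<d z 2 | a≡a%ℕn+[a/ℕn]*n z 2
%ℕ2-unique z 0 q _ z≡ | 0 | _ | _ = refl
%ℕ2-unique z 1 q _ z≡ | 1 | _ | _ = refl
%ℕ2-unique z 0 q _ z≡ | 1 | _ | z≡′ =
  contradiction (trans (sym z≡′) (trans z≡ (ℤₚ.+-identityˡ _))) (odd≢even (z /ℕ 2) q)
%ℕ2-unique z 1 q _ z≡ | 0 | _ | z≡′ =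
  contradiction (trans (sym z≡) (trans z≡′ (ℤₚ.+-identityˡ _))) (odd≢even q (z /ℕ 2))
%ℕ2-unique z (suc (suc _)) q (s≤s (s≤s ())) z≡ | _ | _ | _
%ℕ2-unique z _ q _ z≡ | suc (suc _) | s≤s (s≤s ()) | _

bit-even : ∀ q → bit (q * + 2) ≡ false
bit-even q = cong (_≡ᵇ 1) (%ℕ2-unique (q * + 2) 0 q (s≤s z≤n) (sym (ℤₚ.+-identityˡ _)))

bit-odd : ∀ q → bit (+ 1 + q * + 2) ≡ true
bit-odd q = cong (_≡ᵇ 1) (%ℕ2-unique (+ 1 + q * + 2) 1 q ℕₚ.≤-refl refl)

data Parity : ℤ → Set where
  even : ∀ q → Parity (q * + 2)
  odd  : ∀ q → Parity (+ 1 + q * + 2)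

parity : ∀ z → Parity z
parity z with z %ℕ 2 | n%ℕd<d z 2 | a≡a%ℕn+[a/ℕn]*n z 2
... | 0           | _            | z≡ = subst Parity (sym (trans z≡ (ℤₚ.+-identityˡ _))) (even (z /ℕ 2))
... | 1           | _            | z≡ = subst Parity (sym z≡) (odd (z /ℕ 2))
... | suc (suc _) | s≤s (s≤s ()) | _

bit-+ : ∀ x y → bit (x + y) ≡ bit x xor bit y
bit-+ x y with parity x | parity y
... | even p | even q rewrite bit-even p | bit-even q = trans (cong bit (sum≡ p q)) (bit-even (p + q))
  where sum≡ : ∀ p q → p * + 2 + q * + 2 ≡ (p + q) * + 2
        sum≡ = solve-∀
... | even p | odd q  rewrite bit-even p | bit-odd q  = trans (cong bit (sum≡ p q)) (bit-odd (p + q))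
  where sum≡ : ∀ p q → p * + 2 + (+ 1 + q * + 2) ≡ + 1 + (p + q) * + 2
        sum≡ = solve-∀
... | odd p  | even q rewrite bit-odd p  | bit-even q = trans (cong bit (sum≡ p q)) (bit-odd (p + q))
  where sum≡ : ∀ p q → (+ 1 + p * + 2) + q * + 2 ≡ + 1 + (p + q) * + 2
        sum≡ = solve-∀
... | odd p  | odd q  rewrite bit-odd p  | bit-odd q  = trans (cong bit (sum≡ p q)) (bit-even (+ 1 + p + q))
  where sum≡ : ∀ p q → (+ 1 + p * + 2) + (+ 1 + q * + 2) ≡ (+ 1 + p + q) * + 2
        sum≡ = solve-∀

bit-* : ∀ x y → bit (x * y) ≡ bit x ∧ bit y
bit-* x y with parity x | parity y
... | even p | _      rewrite bit-even p = trans (cong bit (prod≡ p y)) (bit-even (p * y))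
  where prod≡ : ∀ p y → p * + 2 * y ≡ (p * y) * + 2
        prod≡ = solve-∀
... | odd p  | even q rewrite bit-odd p | bit-even q =
  trans (cong bit (prod≡ p q)) (bit-even (q + p * q * + 2))
  where prod≡ : ∀ p q → (+ 1 + p * + 2) * (q * + 2) ≡ (q + p * q * + 2) * + 2
        prod≡ = solve-∀
... | odd p  | odd q  rewrite bit-odd p | bit-odd q =
  trans (cong bit (prod≡ p q)) (bit-odd (p + q + p * q * + 2))
  where prod≡ : ∀ p q → (+ 1 + p * + 2) * (+ 1 + q * + 2) ≡ + 1 + (p + q + p * q * + 2) * + 2
        prod≡ = solve-∀

2∣⇒bit≡false : ∀ z → + 2 ∣ z → bit z ≡ false
2∣⇒bit≡false z 2∣z with Signed.∣ᵤ⇒∣ {+ 2} {z} 2∣z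
... | Signed.divides q refl = bit-even q

bit≡false⇒2∣ : ∀ z → bit z ≡ false → + 2 ∣ z
bit≡false⇒2∣ z with parity z
... | even q = λ _ → Signed.∣⇒∣ᵤ (Signed.divides q refl)
... | odd q  = λ even → contradiction (trans (sym (bit-odd q)) even) λ ()

odd-factors : ∀ a c → ¬ (+ 2 ∣ a * c) → bit a ≡ true × bit c ≡ true
odd-factors a c 2∤ac = ∧-conicalˡ _ _ ac-odd , ∧-conicalʳ _ _ ac-odd
  where
  ac-odd : bit a ∧ bit c ≡ true
  ac-odd = trans (sym (bit-* a c)) (¬-not (2∤ac ∘ bit≡false⇒2∣ (a * c)))

bit-/2 : ∀ z w → z ≡ w * + 2 → bit (z / + 2) ≡ bit w
bit-/2 z w z≡w*2 =
  cong bit (trans (div-pos-is-/ℕ z 2) (ℤₚ.*-cancelʳ-≡ (z /ℕ 2) w (+ 2) (trans (sym z≡) z≡w*2)))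
  where
  z%2≡0 : z %ℕ 2 ≡ 0
  z%2≡0 = %ℕ2-unique z 0 w (s≤s z≤n) (trans z≡w*2 (sym (ℤₚ.+-identityˡ _)))
  z≡ : z ≡ (z /ℕ 2) * + 2
  z≡ = trans (a≡a%ℕn+[a/ℕn]*n z 2)
             (trans (cong (λ r → + r + (z /ℕ 2) * + 2) z%2≡0) (ℤₚ.+-identityˡ _))

bit≡bit[%ℕ4] : ∀ z → bit z ≡ bit (+ (z %ℕ 4))
bit≡bit[%ℕ4] z = begin
  bit z                        ≡⟨ cong bit (a≡a%ℕn+[a/ℕn]*n z 4) ⟩
  bit (+ r + q * + 4)          ≡⟨ bit-+ (+ r) (q * + 4) ⟩
  bit (+ r) xor bit (q * + 4)  ≡⟨ cong (bit (+ r) xor_) (trans (bit-* q (+ 4)) (∧-zeroʳ (bit q))) ⟩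
  bit (+ r) xor false          ≡⟨ xor-identityʳ (bit (+ r)) ⟩
  bit (+ r)                    ∎
  where
  open ≡-Reasoning
  r = z %ℕ 4
  q = z /ℕ 4

triangular : ℤ → ℤ
triangular a = (a + a * a) / + 2

bit-triangular-1+4q : ∀ q → bit (triangular (+ 1 + q * + 4)) ≡ true
bit-triangular-1+4q q = trans (bit-/2 _ (+ 1 + w * + 2) (sum≡ q)) (bit-odd w)
  where
  w = q * + 3 + q * q * + 4
  sum≡ : ∀ q → (+ 1 + q * + 4) + (+ 1 + q * + 4) * (+ 1 + q * + 4)
               ≡ (+ 1 + (q * + 3 + q * q * + 4) * + 2) * + 2
  sum≡ = solve-∀

bit-triangular-3+4q : ∀ q → bit (triangular (+ 3 + q * + 4)) ≡ false
bit-triangular-3+4q q = trans (bit-/2 _ (w * + 2) (sum≡ q)) (bit-even w)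
  where
  w = + 3 + q * + 7 + q * q * + 4
  sum≡ : ∀ q → (+ 3 + q * + 4) + (+ 3 + q * + 4) * (+ 3 + q * + 4)
               ≡ ((+ 3 + q * + 7 + q * q * + 4) * + 2) * + 2
  sum≡ = solve-∀

bit-triangular : ∀ a → bit a ≡ true → bit (triangular a) ≡ (a %ℕ 4 ≡ᵇ 1)
bit-triangular a a-odd with a %ℕ 4 | n%ℕd<d a 4 | a≡a%ℕn+[a/ℕn]*n a 4 | bit≡bit[%ℕ4] a
... | 0 | _ | _  | a-even = contradiction (trans (sym a-odd) a-even) λ ()
... | 1 | _ | a≡ | _      = trans (cong (bit ∘ triangular) a≡) (bit-triangular-1+4q (a /ℕ 4))
... | 2 | _ | _  | a-even = contradiction (trans (sym a-odd) a-even) λ ()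
... | 3 | _ | a≡ | _      = trans (cong (bit ∘ triangular) a≡) (bit-triangular-3+4q (a /ℕ 4))
... | suc (suc (suc (suc _))) | s≤s (s≤s (s≤s (s≤s ()))) | _ | _

bit-half-of-2+4q : ∀ q → bit ((+ 2 + q * + 4) / + 2) ≡ true
bit-half-of-2+4q q = trans (bit-/2 _ (+ 1 + q * + 2) (2+4q≡ q)) (bit-odd q)
  where
  2+4q≡ : ∀ q → + 2 + q * + 4 ≡ (+ 1 + q * + 2) * + 2
  2+4q≡ = solve-∀

bit-half-of-2mod4 : ∀ b → + 2 ∣ b → ¬ (+ 4 ∣ b) → bit (b / + 2) ≡ true
bit-half-of-2mod4 b 2∣b 4∤b with b %ℕ 4 | n%ℕd<d b 4 | a≡a%ℕn+[a/ℕn]*n b 4 | bit≡bit[%ℕ4] b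
... | 0 | _ | b≡ | _     = contradiction (Signed.∣⇒∣ᵤ (Signed.divides (b /ℕ 4) b≡q*4)) 4∤b
  where b≡q*4 = trans b≡ (ℤₚ.+-identityˡ _)
... | 1 | _ | _  | b-odd = contradiction (trans (sym (2∣⇒bit≡false b 2∣b)) b-odd) λ ()
... | 2 | _ | b≡ | _     = trans (cong (λ z → bit (z / + 2)) b≡) (bit-half-of-2+4q (b /ℕ 4))
... | 3 | _ | _  | b-odd = contradiction (trans (sym (2∣⇒bit≡false b 2∣b)) b-odd) λ ()
... | suc (suc (suc (suc _))) | s≤s (s≤s (s≤s (s≤s ()))) | _ | _

-- 𝔽₂[x] up to coefficientwise equality

coeff : F2Poly → ℕ → Bool
coeff []      _       = false
coeff (a ∷ _) zero    = a
coeff (_ ∷ p) (suc i) = coeff p i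

-- Equivalent to _≈₂_ (≈₂⇒≐, ≐⇒≈₂) but pointwise, hence easy to reason with.
infix 4 _≐_
record _≐_ (p q : F2Poly) : Set where
  constructor coeffwise
  field coeff-≡ : ∀ i → coeff p i ≡ coeff q i
open _≐_

≐-refl : ∀ {p} → p ≐ p
≐-refl = coeffwise λ _ → refl

≐-sym : ∀ {p q} → p ≐ q → q ≐ p
≐-sym p≐q = coeffwise λ i → sym (coeff-≡ p≐q i)

≐-trans : ∀ {p q r} → p ≐ q → q ≐ r → p ≐ r
≐-trans p≐q q≐r = coeffwise λ i → trans (coeff-≡ p≐q i) (coeff-≡ q≐r i)

≐-setoid : Setoid _ _
≐-setoid = record
  { Carrier = F2Poly ; _≈_ = _≐_
  ; isEquivalence = record { refl = ≐-refl ; sym = ≐-sym ; trans = ≐-trans } }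

module ≐-Reasoning = SetoidReasoning ≐-setoid

-- (a ∷ p) *₂ q reduces to a ·₂ q +₂ (false ∷ p *₂ q).
infixr 7 _·₂_
_·₂_ : Bool → F2Poly → F2Poly
β ·₂ q = if β then q else []

mono₂ : ℕ → Bool → F2Poly
mono₂ k β = replicate k false ++ β ∷ []

x^_ : ℕ → F2Poly
x^ k = mono₂ k true

coeff-+₂ : ∀ p q i → coeff (p +₂ q) i ≡ coeff p i xor coeff q i
coeff-+₂ []      q       i       = refl
coeff-+₂ (a ∷ p) []      i       = sym (xor-identityʳ _)
coeff-+₂ (a ∷ p) (b ∷ q) zero    = refl
coeff-+₂ (a ∷ p) (b ∷ q) (suc i) = coeff-+₂ p q i

coeff-·₂ : ∀ β q i → coeff (β ·₂ q) i ≡ β ∧ coeff q i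
coeff-·₂ true  q i = refl
coeff-·₂ false q i = refl

xor≡false⇒≡ : ∀ x y → x xor y ≡ false → x ≡ y
xor≡false⇒≡ true  true  _ = refl
xor≡false⇒≡ false false _ = refl

≈₂⇒≐ : ∀ {p q} → p ≈₂ q → p ≐ q
≈₂⇒≐ {p} {q} p+q≈0 = coeffwise λ i →
  xor≡false⇒≡ _ _ (trans (sym (coeff-+₂ p q i)) (zero-coeff p+q≈0 i))
  where
  zero-coeff : ∀ {r} → IsZero₂ r → ∀ i → coeff r i ≡ false
  zero-coeff []         i       = refl
  zero-coeff (r₀≡0 ∷ _) zero    = r₀≡0
  zero-coeff (_ ∷ r≈0)  (suc i) = zero-coeff r≈0 i

≐⇒≈₂ : ∀ {p q} → p ≐ q → p ≈₂ q
≐⇒≈₂ {p} {q} p≐q = zero-coeff (p +₂ q) λ i →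
  trans (coeff-+₂ p q i)
        (trans (cong (_xor coeff q i) (coeff-≡ p≐q i)) (xor-same (coeff q i)))
  where
  zero-coeff : ∀ r → (∀ i → coeff r i ≡ false) → IsZero₂ r
  zero-coeff []      _ = []
  zero-coeff (_ ∷ r) z = z zero ∷ zero-coeff r (z ∘ suc)

∷-cong : ∀ a {p q} → p ≐ q → a ∷ p ≐ a ∷ q
∷-cong a p≐q = coeffwise λ { zero → refl ; (suc i) → coeff-≡ p≐q i }

false∷≐[] : ∀ {p} → p ≐ [] → false ∷ p ≐ []
false∷≐[] p≐[] = coeffwise λ { zero → refl ; (suc i) → coeff-≡ p≐[] i }

+₂-identityʳ : ∀ p → p +₂ [] ≡ p
+₂-identityʳ []      = refl
+₂-identityʳ (_ ∷ _) = refl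

+₂-cong : ∀ {p p′ q q′} → p ≐ p′ → q ≐ q′ → p +₂ q ≐ p′ +₂ q′
+₂-cong {p} {p′} {q} {q′} p≐p′ q≐q′ = coeffwise λ i →
  trans (coeff-+₂ p q i)
        (trans (cong₂ _xor_ (coeff-≡ p≐p′ i) (coeff-≡ q≐q′ i)) (sym (coeff-+₂ p′ q′ i)))

≡⇒≐ : ∀ {p q} → p ≡ q → p ≐ q
≡⇒≐ refl = ≐-refl

+₂-interchange : ∀ p q r s → (p +₂ q) +₂ (r +₂ s) ≐ (p +₂ r) +₂ (q +₂ s)
+₂-interchange p q r s = coeffwise λ i → begin
  coeff ((p +₂ q) +₂ (r +₂ s)) i
    ≡⟨ expand p q r s i ⟩
  (coeff p i xor coeff q i) xor (coeff r i xor coeff s i)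
    ≡⟨ solve 4 (λ P Q R S → (P :+ Q) :+ (R :+ S) := (P :+ R) :+ (Q :+ S)) refl
             (coeff p i) (coeff q i) (coeff r i) (coeff s i) ⟩
  (coeff p i xor coeff r i) xor (coeff q i xor coeff s i)
    ≡⟨ expand p r q s i ⟨
  coeff ((p +₂ r) +₂ (q +₂ s)) i
    ∎
  where
  open ≡-Reasoning
  open 𝔽₂-Solver using (solve; _:+_; _:=_)
  expand : ∀ p q r s i →
           coeff ((p +₂ q) +₂ (r +₂ s)) i ≡ (coeff p i xor coeff q i) xor (coeff r i xor coeff s i)
  expand p q r s i =
    trans (coeff-+₂ (p +₂ q) (r +₂ s) i) (cong₂ _xor_ (coeff-+₂ p q i) (coeff-+₂ r s i))

·₂-cong : ∀ β {q q′} → q ≐ q′ → β ·₂ q ≐ β ·₂ q′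
·₂-cong true  q≐q′ = q≐q′
·₂-cong false q≐q′ = ≐-refl

·₂-distribˡ-+₂ : ∀ β q r → β ·₂ (q +₂ r) ≐ β ·₂ q +₂ β ·₂ r
·₂-distribˡ-+₂ true  q r = ≐-refl
·₂-distribˡ-+₂ false q r = ≐-refl

·₂-distribʳ-xor : ∀ a b r → (a xor b) ·₂ r ≐ a ·₂ r +₂ b ·₂ r
·₂-distribʳ-xor a b r = coeffwise λ i →
  trans (coeff-·₂ (a xor b) r i)
    (trans (∧-distribʳ-xor (coeff r i) a b)
      (sym (trans (coeff-+₂ (a ·₂ r) (b ·₂ r) i) (cong₂ _xor_ (coeff-·₂ a r i) (coeff-·₂ b r i)))))

·₂-*₂ : ∀ β q r → (β ·₂ q) *₂ r ≐ β ·₂ (q *₂ r)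
·₂-*₂ true  q r = ≐-refl
·₂-*₂ false q r = ≐-refl

*₂-zeroʳ : ∀ p → p *₂ [] ≐ []
*₂-zeroʳ []          = ≐-refl
*₂-zeroʳ (true  ∷ p) = false∷≐[] (*₂-zeroʳ p)
*₂-zeroʳ (false ∷ p) = false∷≐[] (*₂-zeroʳ p)

*₂-identityʳ : ∀ p → p *₂ one₂ ≐ p
*₂-identityʳ []          = ≐-refl
*₂-identityʳ (true  ∷ p) = ∷-cong true (*₂-identityʳ p)
*₂-identityʳ (false ∷ p) = ∷-cong false (*₂-identityʳ p)

*₂-identityˡ : ∀ p → one₂ *₂ p ≐ p
*₂-identityˡ p = coeffwise λ i →
  trans (coeff-+₂ p (false ∷ []) i)
        (trans (cong (coeff p i xor_) (coeff-0 i)) (xor-identityʳ (coeff p i)))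
  where
  coeff-0 : ∀ i → coeff (false ∷ []) i ≡ false
  coeff-0 zero    = refl
  coeff-0 (suc _) = refl

*₂-congʳ : ∀ p {q q′} → q ≐ q′ → p *₂ q ≐ p *₂ q′
*₂-congʳ []      q≐q′ = ≐-refl
*₂-congʳ (a ∷ p) q≐q′ = +₂-cong (·₂-cong a q≐q′) (∷-cong false (*₂-congʳ p q≐q′))

≐[]⇒*₂≐[] : ∀ {p} q → p ≐ [] → p *₂ q ≐ []
≐[]⇒*₂≐[] {[]}        q p≐[] = ≐-refl
≐[]⇒*₂≐[] {true  ∷ p} q p≐[] = contradiction (coeff-≡ p≐[] 0) λ ()
≐[]⇒*₂≐[] {false ∷ p} q p≐[] =
  false∷≐[] (≐[]⇒*₂≐[] {p} q (coeffwise (coeff-≡ p≐[] ∘ suc)))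

*₂-congˡ : ∀ {p p′} q → p ≐ p′ → p *₂ q ≐ p′ *₂ q
*₂-congˡ {[]}    {_}      q p≐p′ = ≐-sym (≐[]⇒*₂≐[] q (≐-sym p≐p′))
*₂-congˡ {_ ∷ _} {[]}     q p≐p′ = ≐[]⇒*₂≐[] q p≐p′
*₂-congˡ {a ∷ p} {_ ∷ p′} q p≐p′ with coeff-≡ p≐p′ 0
... | refl =
  +₂-cong ≐-refl (∷-cong false (*₂-congˡ {p} {p′} q (coeffwise (coeff-≡ p≐p′ ∘ suc))))

*₂-distribˡ-+₂ : ∀ p q r → p *₂ (q +₂ r) ≐ p *₂ q +₂ p *₂ r
*₂-distribˡ-+₂ []      q r = ≐-refl
*₂-distribˡ-+₂ (a ∷ p) q r = ≐-trans
  (+₂-cong (·₂-distribˡ-+₂ a q r) (∷-cong false (*₂-distribˡ-+₂ p q r)))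
  (+₂-interchange (a ·₂ q) (a ·₂ r) (false ∷ p *₂ q) (false ∷ p *₂ r))

*₂-distribʳ-+₂ : ∀ p q r → (p +₂ q) *₂ r ≐ p *₂ r +₂ q *₂ r
*₂-distribʳ-+₂ []      q       r = ≐-refl
*₂-distribʳ-+₂ (a ∷ p) []      r = ≡⇒≐ (sym (+₂-identityʳ ((a ∷ p) *₂ r)))
*₂-distribʳ-+₂ (a ∷ p) (b ∷ q) r = ≐-trans
  (+₂-cong (·₂-distribʳ-xor a b r) (∷-cong false (*₂-distribʳ-+₂ p q r)))
  (+₂-interchange (a ·₂ r) (b ·₂ r) (false ∷ p *₂ r) (false ∷ q *₂ r))

*₂-assoc : ∀ p q r → (p *₂ q) *₂ r ≐ p *₂ (q *₂ r)
*₂-assoc []      q r = ≐-refl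
*₂-assoc (a ∷ p) q r = ≐-trans
  (*₂-distribʳ-+₂ (a ·₂ q) (false ∷ p *₂ q) r)
  (+₂-cong (·₂-*₂ a q r) (∷-cong false (*₂-assoc p q r)))

∣₂-resp-≐ : ∀ d {f f′} → d ∣₂ f → f ≐ f′ → d ∣₂ f′
∣₂-resp-≐ d (q , dq≈f) f≐f′ = q , ≐⇒≈₂ (≐-trans (≈₂⇒≐ dq≈f) f≐f′)

∣₂-+*₂ : ∀ d {f g} → d ∣₂ f → d ∣₂ g → ∀ r → d ∣₂ f +₂ g *₂ r
∣₂-+*₂ d {f} {g} (s , ds≈f) (t , dt≈g) r = s +₂ t *₂ r , ≐⇒≈₂ (begin
  d *₂ (s +₂ t *₂ r)       ≈⟨ *₂-distribˡ-+₂ d s (t *₂ r) ⟩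
  d *₂ s +₂ d *₂ (t *₂ r)  ≈⟨ +₂-cong ds≐f (≐-sym (*₂-assoc d t r)) ⟩
  f +₂ (d *₂ t) *₂ r       ≈⟨ +₂-cong (≐-refl {f}) (*₂-congˡ r dt≐g) ⟩
  f +₂ g *₂ r              ∎)
  where
  open ≐-Reasoning
  ds≐f : d *₂ s ≐ f
  ds≐f = ≈₂⇒≐ ds≈f
  dt≐g : d *₂ t ≐ g
  dt≐g = ≈₂⇒≐ dt≈g

coprime-resp : ∀ {f f′ g g′} → f ≐ f′ → g ≐ g′ → Coprime₂ f′ g′ → Coprime₂ f g
coprime-resp f≐f′ g≐g′ coprime d d∣f d∣g =
  coprime d (∣₂-resp-≐ d d∣f f≐f′) (∣₂-resp-≐ d d∣g g≐g′)

coprime-oneˡ : ∀ {g} → Coprime₂ one₂ g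
coprime-oneˡ d d∣1 _ = d∣1

coprime-oneʳ : ∀ {f} → Coprime₂ f one₂
coprime-oneʳ d _ d∣1 = d∣1

coprime-+*₂ˡ : ∀ {f g} r → Coprime₂ (f +₂ g *₂ r) g → Coprime₂ f g
coprime-+*₂ˡ r coprime d d∣f d∣g = coprime d (∣₂-+*₂ d d∣f d∣g r) d∣g

coprime-+*₂ʳ : ∀ {f g} r → Coprime₂ f (g +₂ f *₂ r) → Coprime₂ f g
coprime-+*₂ʳ r coprime d d∣f d∣g = coprime d d∣f (∣₂-+*₂ d d∣g d∣f r)

¬coprime-zero : ∀ {f g} → f ≐ [] → ¬ IsUnit₂ g → ¬ Coprime₂ f g
¬coprime-zero {f} {g} f≐[] g-nonunit coprime = g-nonunit (coprime g g∣f g∣g)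
  where
  g∣f : g ∣₂ f
  g∣f = [] , ≐⇒≈₂ (≐-trans (*₂-zeroʳ g) (≐-sym f≐[]))
  g∣g : g ∣₂ g
  g∣g = one₂ , ≐⇒≈₂ (*₂-identityʳ g)

-- Units have degree zero

coeff-leading : ∀ w → coeff (w ++ true ∷ []) (length w) ≡ true
coeff-leading []      = refl
coeff-leading (_ ∷ w) = coeff-leading w

coeff-beyond-leading : ∀ w {i} → length w < i → coeff (w ++ true ∷ []) i ≡ false
coeff-beyond-leading []      {suc i} _           = refl
coeff-beyond-leading (_ ∷ w) {suc i} (s≤s |w|<i) = coeff-beyond-leading w |w|<i

coeff-*₂-leading : ∀ w u →
                   coeff ((w ++ true ∷ []) *₂ (u ++ true ∷ [])) (length w ℕ.+ length u) ≡ true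
coeff-*₂-leading []      u =
  trans (coeff-≡ (*₂-identityˡ (u ++ true ∷ [])) (length u)) (coeff-leading u)
coeff-*₂-leading (a ∷ w) u = begin
  coeff (a ·₂ q +₂ (false ∷ p *₂ q)) (suc n)  ≡⟨ coeff-+₂ (a ·₂ q) (false ∷ p *₂ q) (suc n) ⟩
  coeff (a ·₂ q) (suc n) xor coeff (p *₂ q) n  ≡⟨ cong₂ _xor_ above-u (coeff-*₂-leading w u) ⟩
  false xor true                               ∎
  where
  open ≡-Reasoning
  p = w ++ true ∷ []
  q = u ++ true ∷ []
  n = length w ℕ.+ length u
  above-u : coeff (a ·₂ q) (suc n) ≡ false
  above-u = trans (coeff-·₂ a q (suc n)) (trans (cong (a ∧_) (coeff-beyond-leading u |u|<1+n)) (∧-zeroʳ a))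
    where |u|<1+n = s≤s (ℕₚ.m≤n+m (length u) (length w))

≐[]⊎≐leading : ∀ p → p ≐ [] ⊎ ∃ λ w → p ≐ w ++ true ∷ []
≐[]⊎≐leading [] = inj₁ ≐-refl
≐[]⊎≐leading (a ∷ p) with ≐[]⊎≐leading p
... | inj₂ (w , p≐w1) = inj₂ (a ∷ w , ∷-cong a p≐w1)
≐[]⊎≐leading (true  ∷ p) | inj₁ p≐[] = inj₂ ([] , ∷-cong true p≐[])
≐[]⊎≐leading (false ∷ p) | inj₁ p≐[] = inj₁ (false∷≐[] p≐[])

nonconstant-not-unit : ∀ a w → ¬ IsUnit₂ (a ∷ w ++ true ∷ [])
nonconstant-not-unit a w (v , pv≈1) = [ v≢0 , v-not-leading ]′ (≐[]⊎≐leading v)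
  where
  p = a ∷ w ++ true ∷ []
  1≐pv : one₂ ≐ p *₂ v
  1≐pv = ≐-sym (≈₂⇒≐ pv≈1)
  v≢0 : ¬ v ≐ []
  v≢0 v≐[] = contradiction (coeff-≡ (≐-trans 1≐pv (≐-trans (*₂-congʳ p v≐[]) (*₂-zeroʳ p))) 0) λ ()
  v-not-leading : ¬ ∃ λ u → v ≐ u ++ true ∷ []
  v-not-leading (u , v≐u1) =
    contradiction (trans (coeff-≡ (≐-trans 1≐pv (*₂-congʳ p v≐u1)) _) (coeff-*₂-leading (a ∷ w) u)) λ ()

-- The trinomials x^m + x + 1

trinomial : ℕ → F2Poly
trinomial m = x^ m +₂ x^ 1 +₂ x^ 0

trinomial-+*₂ : ∀ β k → trinomial (2 ℕ.+ k) +₂ (β ∷ false ∷ true ∷ []) *₂ x^ k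
                         ≐ β ·₂ x^ k +₂ x^ 1 +₂ x^ 0
trinomial-+*₂ β k = ≐-trans (+₂-cong (≐-refl {trinomial (2 ℕ.+ k)}) product) (coeffwise λ i → begin
  coeff (trinomial (2 ℕ.+ k) +₂ (β ·₂ x^ k +₂ x^ (2 ℕ.+ k))) i
    ≡⟨ coeff-+₂ (trinomial (2 ℕ.+ k)) (β ·₂ x^ k +₂ x^ (2 ℕ.+ k)) i ⟩
  coeff (trinomial (2 ℕ.+ k)) i xor coeff (β ·₂ x^ k +₂ x^ (2 ℕ.+ k)) i
    ≡⟨ cong₂ _xor_ (coeff-+₂³ (x^ (2 ℕ.+ k)) (x^ 1) (x^ 0) i)
                   (trans (coeff-+₂ (β ·₂ x^ k) (x^ (2 ℕ.+ k)) i) (cong (_xor _) (coeff-·₂ β (x^ k) i))) ⟩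
  ((A i xor B i) xor C i) xor ((β ∧ D i) xor A i)
    ≡⟨ solve 5 (λ A B C D β → ((A :+ B) :+ C) :+ ((β :* D) :+ A) := ((β :* D) :+ B) :+ C) refl
             (A i) (B i) (C i) (D i) β ⟩
  ((β ∧ D i) xor B i) xor C i
    ≡⟨ trans (coeff-+₂³ (β ·₂ x^ k) (x^ 1) (x^ 0) i)
             (cong (λ x → (x xor B i) xor C i) (coeff-·₂ β (x^ k) i)) ⟨
  coeff (β ·₂ x^ k +₂ x^ 1 +₂ x^ 0) i
    ∎)
  where
  open ≡-Reasoning
  open 𝔽₂-Solver using (solve; _:+_; _:*_; _:=_)
  A B C D : ℕ → Bool
  A = coeff (x^ (2 ℕ.+ k))
  B = coeff (x^ 1)
  C = coeff (x^ 0)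
  D = coeff (x^ k)
  coeff-+₂³ : ∀ p q r i → coeff (p +₂ q +₂ r) i ≡ (coeff p i xor coeff q i) xor coeff r i
  coeff-+₂³ p q r i = trans (coeff-+₂ (p +₂ q) r i) (cong (_xor coeff r i) (coeff-+₂ p q i))
  product : (β ∷ false ∷ true ∷ []) *₂ x^ k ≐ β ·₂ x^ k +₂ x^ (2 ℕ.+ k)
  product = +₂-cong (≐-refl {β ·₂ x^ k}) (∷-cong false (∷-cong false (*₂-identityˡ (x^ k))))

coprime-x²+1-trinomial : ∀ m → Coprime₂ (true ∷ false ∷ true ∷ []) (trinomial m)
coprime-x²+1-trinomial 0 =
  coprime-+*₂ˡ (x^ 1) (coprime-resp (≈₂⇒≐ (refl ∷ refl ∷ refl ∷ [])) ≐-refl coprime-oneˡ)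
coprime-x²+1-trinomial 1 = coprime-resp ≐-refl (≈₂⇒≐ (refl ∷ refl ∷ [])) coprime-oneʳ
coprime-x²+1-trinomial (suc (suc k)) =
  coprime-+*₂ʳ (x^ k) (coprime-resp ≐-refl (trinomial-+*₂ true k) (coprime-x²+1-trinomial k))

coprime-x²-trinomial : ∀ k → Coprime₂ (false ∷ false ∷ true ∷ []) (trinomial (2 ℕ.+ k))
coprime-x²-trinomial k =
  coprime-+*₂ʳ (x^ k) (coprime-resp ≐-refl (trinomial-+*₂ false k) coprime-x²-1+x)
  where
  coprime-x²-1+x : Coprime₂ (false ∷ false ∷ true ∷ []) (true ∷ true ∷ [])
  coprime-x²-1+x =
    coprime-+*₂ˡ (true ∷ true ∷ []) (coprime-resp (≈₂⇒≐ (refl ∷ refl ∷ refl ∷ [])) ≐-refl coprime-oneˡ)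

trinomial-not-unit : ∀ k → ¬ IsUnit₂ (trinomial (2 ℕ.+ k))
trinomial-not-unit k =
  subst (¬_ ∘ IsUnit₂) (cong (λ p → true ∷ true ∷ p) (sym (+₂-identityʳ (x^ k))))
        (nonconstant-not-unit true (true ∷ replicate k false))

coprime-criterion : ∀ α γ {m} → 2 ≤ m →
                    Coprime₂ (γ ∷ false ∷ α ∷ []) (trinomial m) ⇔ (T α ⊎ T γ)
coprime-criterion true  true  {m} _ =
  mk⇔ (λ _ → inj₁ _) (λ _ → coprime-x²+1-trinomial m)
coprime-criterion true  false {suc (suc k)} (s≤s (s≤s _)) =
  mk⇔ (λ _ → inj₁ _) (λ _ → coprime-x²-trinomial k)
coprime-criterion false true  _ =
  mk⇔ (λ _ → inj₂ _) (λ _ → coprime-resp (≈₂⇒≐ (refl ∷ refl ∷ refl ∷ [])) ≐-refl coprime-oneˡ)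
coprime-criterion false false {suc (suc k)} (s≤s (s≤s _)) = mk⇔
  (⊥-elim ∘ ¬coprime-zero (≈₂⇒≐ (refl ∷ refl ∷ refl ∷ [])) (trinomial-not-unit k))
  λ { (inj₁ ()) ; (inj₂ ()) }

-- Reduction modulo 2

reduce₂-+ : ∀ p q → reduce₂ (p +ℤ[x] q) ≡ reduce₂ p +₂ reduce₂ q
reduce₂-+ []      q       = refl
reduce₂-+ (_ ∷ _) []      = refl
reduce₂-+ (a ∷ p) (b ∷ q) = cong₂ _∷_ (bit-+ a b) (reduce₂-+ p q)

reduce₂-monoZ : ∀ k z → reduce₂ (monoZ k z) ≡ mono₂ k (bit z)
reduce₂-monoZ zero    z = refl
reduce₂-monoZ (suc k) z = cong (false ∷_) (reduce₂-monoZ k z)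

reduce₂-monomials : ∀ m u v w → reduce₂ (monoZ m u +ℤ[x] monoZ 1 v +ℤ[x] monoZ 0 w)
                                  ≡ mono₂ m (bit u) +₂ mono₂ 1 (bit v) +₂ mono₂ 0 (bit w)
reduce₂-monomials m u v w =
  trans (reduce₂-+ (monoZ m u +ℤ[x] monoZ 1 v) (monoZ 0 w))
        (cong₂ _+₂_ (trans (reduce₂-+ (monoZ m u) (monoZ 1 v))
                           (cong₂ _+₂_ (reduce₂-monoZ m u) (reduce₂-monoZ 1 v)))
                    (reduce₂-monoZ 0 w))

reduce₂-Fpoly : ∀ a b c → bit a ≡ true → bit c ≡ true → + 2 ∣ b → ¬ (+ 4 ∣ b) →
                reduce₂ (Fpoly a b c) ≡ (c %ℕ 4 ≡ᵇ 1) ∷ false ∷ (a %ℕ 4 ≡ᵇ 1) ∷ []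
reduce₂-Fpoly a b c a-odd c-odd 2∣b 4∤b = begin
  reduce₂ (Fpoly a b c)
    ≡⟨ reduce₂-monomials 2 (triangular a) middle (triangular c) ⟩
  bit (triangular c) ∷ bit middle ∷ bit (triangular a) ∷ []
    ≡⟨ cong₂ (λ γ α → γ ∷ bit middle ∷ α ∷ []) (bit-triangular c c-odd) (bit-triangular a a-odd) ⟩
  (c %ℕ 4 ≡ᵇ 1) ∷ bit middle ∷ (a %ℕ 4 ≡ᵇ 1) ∷ []
    ≡⟨ cong (λ β → (c %ℕ 4 ≡ᵇ 1) ∷ β ∷ (a %ℕ 4 ≡ᵇ 1) ∷ []) middle-even ⟩
  (c %ℕ 4 ≡ᵇ 1) ∷ false ∷ (a %ℕ 4 ≡ᵇ 1) ∷ []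
    ∎
  where
  open ≡-Reasoning
  middle = a * c + b / + 2
  middle-even : bit middle ≡ false
  middle-even = begin
    bit (a * c + b / + 2)          ≡⟨ bit-+ (a * c) (b / + 2) ⟩
    bit (a * c) xor bit (b / + 2)  ≡⟨ cong₂ _xor_ (trans (bit-* a c) (cong₂ _∧_ a-odd c-odd))
                                                 (bit-half-of-2mod4 b 2∣b 4∤b) ⟩
    true xor true                  ∎

reduce₂-Gpoly : ∀ m a c → bit a ≡ true → bit c ≡ true → reduce₂ (Gpoly m a c) ≡ trinomial m
reduce₂-Gpoly m a c a-odd c-odd =
  trans (reduce₂-monomials m (+ 1) a c) (cong₂ (λ α γ → x^ m +₂ mono₂ 1 α +₂ mono₂ 0 γ) a-odd c-odd)

2≤n/2 : ∀ {n} → 2 < n → 2 ℕD.∣ n → 2 ≤ n ℕ./ 2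
2≤n/2 2<n (ℕD.divides q refl) = subst (2 ≤_) (sym (m*n/n≡m q 2)) (ℕₚ.*-cancelʳ-< 2 1 q 2<n)

lemma2p3 : (a b c : ℤ) (n : ℕ) →
           ¬ (ℤ.+ 2 ∣ a ℤ.* c) → ℤ.+ 2 ∣ b → ¬ (ℤ.+ 4 ∣ b) →
           2 ℕ.< n → 2 ℕD.∣ n →
           Coprime₂ (reduce₂ (Fpoly a b c)) (reduce₂ (Gpoly (n ℕ./ 2) a c))
             ⇔ (a %ℕ 4 ≡ 1 ⊎ c %ℕ 4 ≡ 1)
lemma2p3 a b c n 2∤ac 2∣b 4∤b 2<n 2∣n with odd-factors a c 2∤ac
... | a-odd , c-odd =
  subst₂ (λ f g → Coprime₂ f g ⇔ (a %ℕ 4 ≡ 1 ⊎ c %ℕ 4 ≡ 1))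
    (sym (reduce₂-Fpoly a b c a-odd c-odd 2∣b 4∤b))
    (sym (reduce₂-Gpoly (n ℕ./ 2) a c a-odd c-odd))
    (⇔.trans (coprime-criterion _ _ (2≤n/2 2<n 2∣n)) (residue a ⊎-⇔ residue c))
  where
  residue : ∀ z → T (z %ℕ 4 ≡ᵇ 1) ⇔ z %ℕ 4 ≡ 1
  residue z = mk⇔ (ℕₚ.≡ᵇ⇒≡ _ 1) (ℕₚ.≡⇒≡ᵇ _ 1)
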